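{- Let $D_1$ and $D_2$ be digraphs, each with at least $2$ vertices, both having the tournament Sidorenko property, and let $v^*\in V(D_1)$ be a vertex such that $D_1[V(D_1)\setminus\{v^*\}]$ is tournament anti-Sidorenko. Then the digraph obtained by substituting $D_2$ for $v^*$ in $D_1$ has the tournament Sidorenko property.
   Context: All digraphs are oriented graphs (no loops, no antiparallel edges). A tournament is an orientation of a complete graph without loops. $t_D(T)=h_D(T)/v(T)^{v(D)}$ where $h_D(T)$ is the number of maps $\phi:V(D)\to V(T)$ with $(\phi(x),\phi(y))\in E(T)$ for every $(x,y)\in E(D)$. $D$ is tournament Sidorenko if $t_D(T)\ge(1-o(1))2^{ -e(D)}$ for every tournament $T$ (with $o(1)\to0$ as $v(T)\to\infty$), and tournament anti-Sidorenko if $t_D(T)\le 2^{ -e(D)}$ for every tournament $T$. For digraphs $D_1,D_2$ and $v^*\in V(D_1)$, substituting $D_2$ for $v^*$ gives the digraph with vertex set $(V(D_1)\setminus\{v^*\})\sqcup V(D_2)$ whose edges are: the edges of $D_1$ between vertices of $V(D_1)\setminus\{v^*\}$; the edges of $D_2$; for $u\in V(D_1)\setminus\{v^*\}$ and $w\in V(D_2)$, the edge $(u,w)$ if $(u,v^*)\in E(D_1)$ and the edge $(w,u)$ if $(v^*,u)\in E(D_1)$. $D[S]$ denotes the induced subdigraph on $S$. -}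

module Defs where

open import Data.Nat using (ℕ; zero; suc; _+_; _*_; _^_; _≤_)
open import Data.Bool using (Bool; true; false; if_then_else_; _∧_; _∨_; not)
open import Data.Fin using (Fin; zero; suc; punchIn; splitAt)
open import Data.Sum using (_⊎_; inj₁; inj₂)
open import Data.Product using (∃-syntax)
open import Relation.Binary.PropositionalEquality using (_≡_; _≢_)
import Data.Vec.Functional as VF

record Digraph : Set where
  constructor mkDigraph
  field
    n : ℕ
    E : Fin n → Fin n → Bool
open Digraph public

-- Oriented: no loops, no antiparallel edges (standing assumption of the paper).
record Oriented (D : Digraph) : Set where
  field
    noLoop : ∀ i → E D i i ≡ false
    noAnti : ∀ i j → E D i j ≡ true → E D j i ≡ false

record Tournament : Set where
  field
    m   : ℕ
    adj : Fin m → Fin m → Bool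
    irrefl : ∀ i → adj i i ≡ false
    exactlyOne : ∀ i j → i ≢ j → adj i j ≢ adj j i
open Tournament public

sumFin : ∀ n → (Fin n → ℕ) → ℕ
sumFin zero f = 0
sumFin (suc n) f = f zero + sumFin n (λ i → f (suc i))

allFin : ∀ n → (Fin n → Bool) → Bool
allFin zero f = true
allFin (suc n) f = f zero ∧ allFin n (λ i → f (suc i))

sumMaps : ∀ v m → ((Fin v → Fin m) → ℕ) → ℕ
sumMaps zero m F = F (λ ())
sumMaps (suc v) m F = sumFin m (λ a → sumMaps v m (λ φ → F (a VF.∷ φ)))

edges : Digraph → ℕ
edges D = sumFin (n D) (λ i → sumFin (n D) (λ j → if E D i j then 1 else 0))

isHom : (D : Digraph) (T : Tournament) → (Fin (n D) → Fin (m T)) → Bool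
isHom D T φ = allFin (n D) (λ x → allFin (n D) (λ y → not (E D x y) ∨ adj T (φ x) (φ y)))

homCount : Digraph → Tournament → ℕ
homCount D T = sumMaps (n D) (m T) (λ φ → if isHom D T φ then 1 else 0)

-- Tournament Sidorenko: t_D(T) ≥ (1 - o(1)) 2^{-e(D)}.  Written with ε = 1/(k+1):
-- for every k there is N such that every tournament T with v(T) ≥ N satisfies
-- h_D(T) / v(T)^{v(D)} ≥ (k/(k+1)) 2^{-e(D)}, i.e.
-- k * v(T)^{v(D)} ≤ (k+1) * 2^{e(D)} * h_D(T).
TournamentSidorenko : Digraph → Set
TournamentSidorenko D =
  ∀ (k : ℕ) → ∃[ N ] (∀ (T : Tournament) → N ≤ m T →
    k * (m T ^ n D) ≤ suc k * (2 ^ edges D) * homCount D T)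

TournamentAntiSidorenko : Digraph → Set
TournamentAntiSidorenko D =
  ∀ (T : Tournament) → 2 ^ edges D * homCount D T ≤ m T ^ n D

-- D[V(D) \ {v}] ; vertex a of the result is vertex (punchIn v a) of D.
deleteVertex : (D : Digraph) → Fin (n D) → Digraph
deleteVertex (mkDigraph zero E₁) ()
deleteVertex (mkDigraph (suc k) E₁) v =
  mkDigraph k (λ a b → E₁ (punchIn v a) (punchIn v b))

-- Substitute D₂ for v in D₁.  Vertex set Fin (k + n₂): the first k vertices
-- are V(D₁)\{v} (via punchIn v), the last n₂ are V(D₂).
substitute : (D₁ : Digraph) → Fin (n D₁) → Digraph → Digraph
substitute (mkDigraph zero E₁) () D₂
substitute (mkDigraph (suc k) E₁) v (mkDigraph n₂ E₂) =
  mkDigraph (k + n₂) (λ x y → edge (splitAt k x) (splitAt k y))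
  where
  edge : Fin k ⊎ Fin n₂ → Fin k ⊎ Fin n₂ → Bool
  edge (inj₁ a) (inj₁ b) = E₁ (punchIn v a) (punchIn v b)
  edge (inj₂ a) (inj₂ b) = E₂ a b
  edge (inj₁ a) (inj₂ b) = E₁ (punchIn v a) v
  edge (inj₂ a) (inj₁ b) = E₁ v (punchIn v b)

-- Write ψ for a homomorphism of D₁ − v into T and N(ψ) ⊆ V(T) for the set of vertices that can be
-- placed at v.  Then h(D₁, T) = Σ_ψ |N(ψ)| and h(D, T) = Σ_ψ h(D₂, T[N(ψ)]).  Sidorenko for D₂ bounds
-- each term below by roughly 2^{-e(D₂)} |N(ψ)|^{v(D₂)}, up to an additive error that only matters
-- for small N(ψ).  By the power-mean inequality
--   (Σ_ψ |N(ψ)|)^{v(D₂)} ≤ h(D₁ − v, T)^{v(D₂) − 1} · Σ_ψ |N(ψ)|^{v(D₂)},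
-- where Sidorenko for D₁ bounds the left side from below and anti-Sidorenko for D₁ − v bounds
-- h(D₁ − v, T) from above; together this gives h(D, T) ≳ 2^{-e(D)} v(T)^{v(D)}.  Everything is done
-- in ℕ, with the error 1/(K+1) shared between the two applications of the Sidorenko property.

module Submission where

open import Defs
open import Algebra.Bundles using (CommutativeMonoid)
import Algebra.Properties.CommutativeSemigroup as CommutativeSemigroupProperties
open import Data.Bool using (Bool; true; false; _∧_; _∨_; not; if_then_else_)
open import Data.Bool.Properties using (∧-assoc; ∧-commutativeMonoid)
open import Data.Fin using (Fin; zero; suc; punchIn; splitAt; _↑ˡ_; _↑ʳ_)
open import Data.Fin.Properties using (splitAt-↑ˡ; splitAt-↑ʳ)
  renaming (suc-injective to Fin-suc-injective)
open import Data.Nat using (ℕ; zero; suc; _+_; _*_; _^_; _≤_; _<_; z≤n; s≤s; NonZero; >-nonZero)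
open import Data.Nat.Properties
open import Data.Nat.Tactic.RingSolver using (solve-∀)
open import Data.Product using (_,_; proj₁; proj₂)
open import Data.Sum using (inj₁; inj₂; [_,_]′)
open import Data.Vec.Functional using (_∷_; _++_; insertAt)
open import Data.Vec.Functional.Properties using (insertAt-lookup; insertAt-punchIn)
open import Function using (_∘_)
open import Relation.Binary.PropositionalEquality
  using (_≡_; refl; sym; trans; cong; cong₂; subst₂; _≗_; module ≡-Reasoning)
open import Relation.Nullary using (yes; no)

module +-CS = CommutativeSemigroupProperties +-commutativeSemigroup
module *-CS = CommutativeSemigroupProperties *-commutativeSemigroup
module ∧-CS = CommutativeSemigroupProperties
  (CommutativeMonoid.commutativeSemigroup ∧-commutativeMonoid)

-- Sums and conjunctions over finite index sets

sumFin-cong : ∀ n {f g : Fin n → ℕ} → f ≗ g → sumFin n f ≡ sumFin n g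
sumFin-cong zero    f≗g = refl
sumFin-cong (suc n) f≗g = cong₂ _+_ (f≗g zero) (sumFin-cong n (f≗g ∘ suc))

sumFin-mono-≤ : ∀ n {f g : Fin n → ℕ} → (∀ i → f i ≤ g i) → sumFin n f ≤ sumFin n g
sumFin-mono-≤ zero    f≤g = z≤n
sumFin-mono-≤ (suc n) f≤g = +-mono-≤ (f≤g zero) (sumFin-mono-≤ n (f≤g ∘ suc))

sumFin-distrib-+ : ∀ n (f g : Fin n → ℕ) →
  sumFin n (λ i → f i + g i) ≡ sumFin n f + sumFin n g
sumFin-distrib-+ zero    f g = refl
sumFin-distrib-+ (suc n) f g =
  trans (cong (f zero + g zero +_) (sumFin-distrib-+ n (f ∘ suc) (g ∘ suc)))
        (+-CS.interchange (f zero) (g zero) _ _)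

sumFin-*ˡ : ∀ n a (f : Fin n → ℕ) → sumFin n (λ i → a * f i) ≡ a * sumFin n f
sumFin-*ˡ zero    a f = sym (*-zeroʳ a)
sumFin-*ˡ (suc n) a f =
  trans (cong (a * f zero +_) (sumFin-*ˡ n a (f ∘ suc))) (sym (*-distribˡ-+ a (f zero) _))

sumFin-const : ∀ n a → sumFin n (λ _ → a) ≡ n * a
sumFin-const zero    a = refl
sumFin-const (suc n) a = cong (a +_) (sumFin-const n a)

sumFin-comm : ∀ n p (f : Fin n → Fin p → ℕ) →
  sumFin n (λ i → sumFin p (f i)) ≡ sumFin p (λ j → sumFin n (λ i → f i j))
sumFin-comm zero    p f = sym (trans (sumFin-const p 0) (*-zeroʳ p))
sumFin-comm (suc n) p f =
  trans (cong (sumFin p (f zero) +_) (sumFin-comm n p (f ∘ suc)))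
        (sym (sumFin-distrib-+ p (f zero) _))

sumFin-++ : ∀ k n (f : Fin (k + n) → ℕ) →
  sumFin (k + n) f ≡ sumFin k (λ i → f (i ↑ˡ n)) + sumFin n (λ j → f (k ↑ʳ j))
sumFin-++ zero    n f = refl
sumFin-++ (suc k) n f =
  trans (cong (f zero +_) (sumFin-++ k n (f ∘ suc))) (sym (+-assoc (f zero) _ _))

sumFin-punchIn : ∀ k (v : Fin (suc k)) (f : Fin (suc k) → ℕ) →
  sumFin (suc k) f ≡ f v + sumFin k (f ∘ punchIn v)
sumFin-punchIn k       zero    f = refl
sumFin-punchIn (suc k) (suc v) f =
  trans (cong (f zero +_) (sumFin-punchIn k v (f ∘ suc))) (+-CS.x∙yz≈y∙xz (f zero) (f (suc v)) _)

allFin-cong : ∀ n {f g : Fin n → Bool} → f ≗ g → allFin n f ≡ allFin n g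
allFin-cong zero    f≗g = refl
allFin-cong (suc n) f≗g = cong₂ _∧_ (f≗g zero) (allFin-cong n (f≗g ∘ suc))

allFin-distrib-∧ : ∀ n (f g : Fin n → Bool) →
  allFin n (λ i → f i ∧ g i) ≡ allFin n f ∧ allFin n g
allFin-distrib-∧ zero    f g = refl
allFin-distrib-∧ (suc n) f g =
  trans (cong ((f zero ∧ g zero) ∧_) (allFin-distrib-∧ n (f ∘ suc) (g ∘ suc)))
        (∧-CS.interchange (f zero) (g zero) _ _)

allFin-true : ∀ n → allFin n (λ _ → true) ≡ true
allFin-true zero    = refl
allFin-true (suc n) = allFin-true n

allFin-comm : ∀ n p (f : Fin n → Fin p → Bool) →
  allFin n (λ i → allFin p (f i)) ≡ allFin p (λ j → allFin n (λ i → f i j))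
allFin-comm zero    p f = sym (allFin-true p)
allFin-comm (suc n) p f =
  trans (cong (allFin p (f zero) ∧_) (allFin-comm n p (f ∘ suc)))
        (sym (allFin-distrib-∧ p (f zero) _))

allFin-++ : ∀ k n (f : Fin (k + n) → Bool) →
  allFin (k + n) f ≡ allFin k (λ i → f (i ↑ˡ n)) ∧ allFin n (λ j → f (k ↑ʳ j))
allFin-++ zero    n f = refl
allFin-++ (suc k) n f =
  trans (cong (f zero ∧_) (allFin-++ k n (f ∘ suc))) (sym (∧-assoc (f zero) _ _))

allFin-punchIn : ∀ k (v : Fin (suc k)) (f : Fin (suc k) → Bool) →
  allFin (suc k) f ≡ f v ∧ allFin k (f ∘ punchIn v)
allFin-punchIn k       zero    f = refl
allFin-punchIn (suc k) (suc v) f =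
  trans (cong (f zero ∧_) (allFin-punchIn k v (f ∘ suc))) (∧-CS.x∙yz≈y∙xz (f zero) (f (suc v)) _)

-- Without function extensionality, re-associated vectors such as a ∷ (ψ ++ χ) and (a ∷ ψ) ++ χ
-- are only pointwise equal, so sums over maps are manipulated for functionals respecting ≗.
Extensional : ∀ {v m} → ((Fin v → Fin m) → ℕ) → Set
Extensional F = ∀ {φ φ′} → φ ≗ φ′ → F φ ≡ F φ′

∷-extensional : ∀ {v m} {F : (Fin (suc v) → Fin m) → ℕ} → Extensional F →
  ∀ a → Extensional (F ∘ (a ∷_))
∷-extensional ext a φ≗φ′ = ext λ { zero → refl ; (suc i) → φ≗φ′ i }

sumMaps-cong : ∀ v m {F G : (Fin v → Fin m) → ℕ} → F ≗ G → sumMaps v m F ≡ sumMaps v m G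
sumMaps-cong zero    m F≗G = F≗G _
sumMaps-cong (suc v) m F≗G = sumFin-cong m (λ a → sumMaps-cong v m (F≗G ∘ (a ∷_)))

sumMaps-mono-≤ : ∀ v m {F G : (Fin v → Fin m) → ℕ} → (∀ φ → F φ ≤ G φ) →
  sumMaps v m F ≤ sumMaps v m G
sumMaps-mono-≤ zero    m F≤G = F≤G _
sumMaps-mono-≤ (suc v) m F≤G = sumFin-mono-≤ m (λ a → sumMaps-mono-≤ v m (F≤G ∘ (a ∷_)))

sumMaps-distrib-+ : ∀ v m (F G : (Fin v → Fin m) → ℕ) →
  sumMaps v m (λ φ → F φ + G φ) ≡ sumMaps v m F + sumMaps v m G
sumMaps-distrib-+ zero    m F G = refl
sumMaps-distrib-+ (suc v) m F G =
  trans (sumFin-cong m (λ a → sumMaps-distrib-+ v m _ _)) (sumFin-distrib-+ m _ _)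

sumMaps-*ˡ : ∀ v m a (F : (Fin v → Fin m) → ℕ) →
  sumMaps v m (λ φ → a * F φ) ≡ a * sumMaps v m F
sumMaps-*ˡ zero    m a F = refl
sumMaps-*ˡ (suc v) m a F = trans (sumFin-cong m (λ b → sumMaps-*ˡ v m a _)) (sumFin-*ˡ m a _)

sumMaps-*ʳ : ∀ v m a (F : (Fin v → Fin m) → ℕ) →
  sumMaps v m (λ φ → F φ * a) ≡ sumMaps v m F * a
sumMaps-*ʳ v m a F = trans (sumMaps-cong v m (λ φ → *-comm (F φ) a))
                           (trans (sumMaps-*ˡ v m a F) (*-comm a _))

sumMaps-comm-sumFin : ∀ v m p (G : (Fin v → Fin m) → Fin p → ℕ) →
  sumMaps v m (λ ψ → sumFin p (G ψ)) ≡ sumFin p (λ w → sumMaps v m (λ ψ → G ψ w))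
sumMaps-comm-sumFin zero    m p G = refl
sumMaps-comm-sumFin (suc v) m p G =
  trans (sumFin-cong m (λ a → sumMaps-comm-sumFin v m p (G ∘ (a ∷_)))) (sumFin-comm m p _)

sumMaps-++ : ∀ k n m (F : (Fin (k + n) → Fin m) → ℕ) → Extensional F →
  sumMaps (k + n) m F ≡ sumMaps k m (λ ψ → sumMaps n m (λ χ → F (ψ ++ χ)))
sumMaps-++ zero    n m F ext = sumMaps-cong n m (λ χ → ext (λ i → refl))
sumMaps-++ (suc k) n m F ext = sumFin-cong m λ a →
  trans (sumMaps-++ k n m (F ∘ (a ∷_)) (∷-extensional ext a))
        (sumMaps-cong k m λ ψ → sumMaps-cong n m λ χ → ext (∷-++ a ψ χ))
  where
  ∷-++ : ∀ a ψ χ → (a ∷ (ψ ++ χ)) ≗ ((a ∷ ψ) ++ χ)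
  ∷-++ a ψ χ zero = refl
  ∷-++ a ψ χ (suc i) with splitAt k i
  ... | inj₁ _ = refl
  ... | inj₂ _ = refl

sumMaps-insertAt : ∀ k m (v : Fin (suc k)) (F : (Fin (suc k) → Fin m) → ℕ) → Extensional F →
  sumMaps (suc k) m F ≡ sumMaps k m (λ ψ → sumFin m (λ w → F (insertAt ψ v w)))
sumMaps-insertAt k m zero F ext =
  trans (sumFin-cong m λ w → sumMaps-cong k m λ ψ → ext (∷-insertAt w ψ))
        (sym (sumMaps-comm-sumFin k m m _))
  where
  ∷-insertAt : ∀ w ψ → (w ∷ ψ) ≗ insertAt ψ zero w
  ∷-insertAt w ψ zero    = refl
  ∷-insertAt w ψ (suc i) = refl
sumMaps-insertAt (suc k) m (suc v) F ext = sumFin-cong m λ a →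
  trans (sumMaps-insertAt k m v (F ∘ (a ∷_)) (∷-extensional ext a))
        (sumMaps-cong k m λ ψ → sumFin-cong m λ w → ext (∷-insertAt a ψ w))
  where
  ∷-insertAt : ∀ a ψ w → (a ∷ insertAt ψ v w) ≗ insertAt (a ∷ ψ) (suc v) w
  ∷-insertAt a ψ w zero    = refl
  ∷-insertAt a ψ w (suc i) = refl

ind : Bool → ℕ
ind b = if b then 1 else 0

ind-∧ : ∀ a b → ind (a ∧ b) ≡ ind a * ind b
ind-∧ true  b = sym (+-identityʳ (ind b))
ind-∧ false b = refl

isHom-extensional : ∀ D T → Extensional (ind ∘ isHom D T)
isHom-extensional D T φ≗φ′ = cong ind (allFin-cong (n D) λ x → allFin-cong (n D) λ y →
  cong₂ (λ a b → not (E D x y) ∨ adj T a b) (φ≗φ′ x) (φ≗φ′ y))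

-- Induced subtournaments

count : ∀ m → (Fin m → Bool) → ℕ
count m P = sumFin m (ind ∘ P)

prepend : ∀ {c m} (b : Bool) → (Fin c → Fin m) → Fin (ind b + c) → Fin (suc m)
prepend true  e zero    = zero
prepend true  e (suc i) = suc (e i)
prepend false e i       = suc (e i)

select : ∀ m (P : Fin m → Bool) → Fin (count m P) → Fin m
select zero    P ()
select (suc m) P = prepend (P zero) (select m (P ∘ suc))

select-injective : ∀ m P {i j} → select m P i ≡ select m P j → i ≡ j
select-injective (suc m) P = prepend-injective (P zero) (select-injective m (P ∘ suc))
  where
  prepend-injective : ∀ {c m} b {e : Fin c → Fin m} → (∀ {i j} → e i ≡ e j → i ≡ j) →
    ∀ {i j} → prepend b e i ≡ prepend b e j → i ≡ j
  prepend-injective true  inj {zero}  {zero}  eq = refl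
  prepend-injective true  inj {suc i} {suc j} eq = cong suc (inj (Fin-suc-injective eq))
  prepend-injective false inj eq = inj (Fin-suc-injective eq)

sumFin-select : ∀ m P (f : Fin m → ℕ) →
  sumFin (count m P) (f ∘ select m P) ≡ sumFin m (λ x → ind (P x) * f x)
sumFin-select zero    P f = refl
sumFin-select (suc m) P f =
  trans (sumFin-prepend (P zero) (select m (P ∘ suc)))
        (cong (ind (P zero) * f zero +_) (sumFin-select m (P ∘ suc) (f ∘ suc)))
  where
  sumFin-prepend : ∀ {c} b (e : Fin c → Fin m) →
    sumFin (ind b + c) (f ∘ prepend b e) ≡ ind b * f zero + sumFin c (f ∘ suc ∘ e)
  sumFin-prepend true  e = cong (_+ sumFin _ (f ∘ suc ∘ e)) (sym (+-identityʳ (f zero)))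
  sumFin-prepend false e = refl

induced : (T : Tournament) → (Fin (m T) → Bool) → Tournament
induced T P = record
  { m          = count (m T) P
  ; adj        = λ i j → adj T (select (m T) P i) (select (m T) P j)
  ; irrefl     = λ i → irrefl T _
  ; exactlyOne = λ i j i≢j → exactlyOne T _ _ (i≢j ∘ select-injective (m T) P)
  }

sumMaps-select : ∀ n m P (F : (Fin n → Fin m) → ℕ) → Extensional F →
  sumMaps n (count m P) (λ φ → F (select m P ∘ φ))
    ≡ sumMaps n m (λ χ → ind (allFin n (P ∘ χ)) * F χ)
sumMaps-select zero    m P F ext = trans (ext (λ ())) (sym (+-identityʳ _))
sumMaps-select (suc n) m P F ext = begin
  sumFin c (λ a → sumMaps n c (λ φ → F (select m P ∘ (a ∷ φ))))
    ≡⟨ sumFin-cong c (λ a → sumMaps-cong n c (λ φ → ext λ { zero → refl ; (suc i) → refl })) ⟩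
  sumFin c (λ a → sumMaps n c (λ φ → F (select m P a ∷ (select m P ∘ φ))))
    ≡⟨ sumFin-cong c (λ a → sumMaps-select n m P _ (∷-extensional ext (select m P a))) ⟩
  sumFin c (g ∘ select m P)
    ≡⟨ sumFin-select m P g ⟩
  sumFin m (λ x → ind (P x) * g x)
    ≡⟨ sumFin-cong m (λ x → trans (sym (sumMaps-*ˡ n m (ind (P x)) _))
         (sumMaps-cong n m (λ χ → trans (sym (*-assoc (ind (P x)) _ _))
                                        (cong (_* F (x ∷ χ)) (sym (ind-∧ (P x) _)))))) ⟩
  sumFin m (λ x → sumMaps n m (λ χ → ind (P x ∧ allFin n (P ∘ χ)) * F (x ∷ χ))) ∎
  where
  open ≡-Reasoning
  c : ℕ
  c = count m P
  g : Fin m → ℕ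
  g x = sumMaps n m (λ χ → ind (allFin n (P ∘ χ)) * F (x ∷ χ))

homCount-induced : ∀ D T P → homCount D (induced T P)
  ≡ sumMaps (n D) (m T) (λ χ → ind (allFin (n D) (P ∘ χ)) * ind (isHom D T χ))
homCount-induced D T P = sumMaps-select (n D) (m T) P (ind ∘ isHom D T) (isHom-extensional D T)

-- Counting homomorphisms of a substitution

module Substitution {k n₂ : ℕ} (E₁ : Fin (suc k) → Fin (suc k) → Bool) (v : Fin (suc k))
                    (E₂ : Fin n₂ → Fin n₂ → Bool) where

  D₁ D₂ D₁′ D : Digraph
  D₁  = mkDigraph (suc k) E₁
  D₂  = mkDigraph n₂ E₂
  D₁′ = deleteVertex D₁ v
  D   = substitute D₁ v D₂

  inDegree outDegree degree : ℕ
  inDegree  = sumFin k (λ a → ind (E₁ (punchIn v a) v))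
  outDegree = sumFin k (λ a → ind (E₁ v (punchIn v a)))
  degree    = inDegree + outDegree

  E-↑ˡ-↑ˡ : ∀ a b → E D (a ↑ˡ n₂) (b ↑ˡ n₂) ≡ E₁ (punchIn v a) (punchIn v b)
  E-↑ˡ-↑ˡ a b rewrite splitAt-↑ˡ k a n₂ | splitAt-↑ˡ k b n₂ = refl

  E-↑ˡ-↑ʳ : ∀ a b → E D (a ↑ˡ n₂) (k ↑ʳ b) ≡ E₁ (punchIn v a) v
  E-↑ˡ-↑ʳ a b rewrite splitAt-↑ˡ k a n₂ | splitAt-↑ʳ k n₂ b = refl

  E-↑ʳ-↑ˡ : ∀ a b → E D (k ↑ʳ a) (b ↑ˡ n₂) ≡ E₁ v (punchIn v b)
  E-↑ʳ-↑ˡ a b rewrite splitAt-↑ʳ k n₂ a | splitAt-↑ˡ k b n₂ = refl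

  E-↑ʳ-↑ʳ : ∀ a b → E D (k ↑ʳ a) (k ↑ʳ b) ≡ E₂ a b
  E-↑ʳ-↑ʳ a b rewrite splitAt-↑ʳ k n₂ a | splitAt-↑ʳ k n₂ b = refl

  edges-host : E₁ v v ≡ false → edges D₁ ≡ edges D₁′ + degree
  edges-host noLoop = begin
    sumFin (suc k) (λ x → sumFin (suc k) (ε x))
      ≡⟨ sumFin-cong (suc k) (λ x → sumFin-punchIn k v (ε x)) ⟩
    sumFin (suc k) (λ x → ε x v + sumFin k (ε x ∘ punchIn v))
      ≡⟨ sumFin-punchIn k v (λ x → ε x v + sumFin k (ε x ∘ punchIn v)) ⟩
    (ε v v + outDegree) + sumFin k (λ a → ε (punchIn v a) v + sumFin k (ε (punchIn v a) ∘ punchIn v))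
      ≡⟨ cong₂ (λ e rest → (ind e + outDegree) + rest) noLoop (sumFin-distrib-+ k _ _) ⟩
    outDegree + (inDegree + edges D₁′)
      ≡⟨ rearrange outDegree inDegree (edges D₁′) ⟩
    edges D₁′ + degree ∎
    where
    open ≡-Reasoning
    ε : Fin (suc k) → Fin (suc k) → ℕ
    ε x y = ind (E₁ x y)
    rearrange : ∀ o i e → o + (i + e) ≡ e + (i + o)
    rearrange = solve-∀

  edges-substitute : edges D ≡ edges D₁′ + edges D₂ + n₂ * degree
  edges-substitute = begin
    sumFin (k + n₂) (λ x → sumFin (k + n₂) (ε x))
      ≡⟨ sumFin-cong (k + n₂) (λ x → sumFin-++ k n₂ (ε x)) ⟩
    sumFin (k + n₂) (λ x → toHost x + toInner x)
      ≡⟨ sumFin-++ k n₂ _ ⟩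
    sumFin k (λ a → toHost (a ↑ˡ n₂) + toInner (a ↑ˡ n₂))
      + sumFin n₂ (λ a → toHost (k ↑ʳ a) + toInner (k ↑ʳ a))
      ≡⟨ cong₂ _+_ (sumFin-distrib-+ k _ _) (sumFin-distrib-+ n₂ _ _) ⟩
    (sumFin k (toHost ∘ (_↑ˡ n₂)) + sumFin k (toInner ∘ (_↑ˡ n₂)))
      + (sumFin n₂ (toHost ∘ (k ↑ʳ_)) + sumFin n₂ (toInner ∘ (k ↑ʳ_)))
      ≡⟨ cong₂ _+_ (cong₂ _+_ host-host host-inner) (cong₂ _+_ inner-host inner-inner) ⟩
    (edges D₁′ + n₂ * inDegree) + (n₂ * outDegree + edges D₂)
      ≡⟨ rearrange (edges D₁′) (edges D₂) n₂ inDegree outDegree ⟩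
    edges D₁′ + edges D₂ + n₂ * degree ∎
    where
    open ≡-Reasoning
    ε : Fin (k + n₂) → Fin (k + n₂) → ℕ
    ε x y = ind (E D x y)
    toHost toInner : Fin (k + n₂) → ℕ
    toHost  x = sumFin k (λ b → ε x (b ↑ˡ n₂))
    toInner x = sumFin n₂ (λ b → ε x (k ↑ʳ b))
    host-host : sumFin k (toHost ∘ (_↑ˡ n₂)) ≡ edges D₁′
    host-host = sumFin-cong k λ a → sumFin-cong k λ b → cong ind (E-↑ˡ-↑ˡ a b)
    host-inner : sumFin k (toInner ∘ (_↑ˡ n₂)) ≡ n₂ * inDegree
    host-inner = trans (sumFin-cong k λ a → trans (sumFin-cong n₂ λ b → cong ind (E-↑ˡ-↑ʳ a b))
                                                  (sumFin-const n₂ _))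
                       (sumFin-*ˡ k n₂ _)
    inner-host : sumFin n₂ (toHost ∘ (k ↑ʳ_)) ≡ n₂ * outDegree
    inner-host = trans (sumFin-cong n₂ λ a → sumFin-cong k λ b → cong ind (E-↑ʳ-↑ˡ a b))
                       (sumFin-const n₂ outDegree)
    inner-inner : sumFin n₂ (toInner ∘ (k ↑ʳ_)) ≡ edges D₂
    inner-inner = sumFin-cong n₂ λ a → sumFin-cong n₂ λ b → cong ind (E-↑ʳ-↑ʳ a b)
    rearrange : ∀ e₁ e₂ n i o → (e₁ + n * i) + (n * o + e₂) ≡ e₁ + e₂ + n * (i + o)
    rearrange = solve-∀

  2^edges-host : E₁ v v ≡ false → 2 ^ edges D₁ ≡ 2 ^ edges D₁′ * 2 ^ degree
  2^edges-host noLoop = trans (cong (2 ^_) (edges-host noLoop)) (^-distribˡ-+-* 2 (edges D₁′) degree)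

  2^edges-substitute : 2 ^ edges D ≡ 2 ^ edges D₁′ * 2 ^ edges D₂ * (2 ^ degree) ^ n₂
  2^edges-substitute = begin
    2 ^ edges D                                    ≡⟨ cong (2 ^_) edges-substitute ⟩
    2 ^ (edges D₁′ + edges D₂ + n₂ * degree)       ≡⟨ ^-distribˡ-+-* 2 (edges D₁′ + edges D₂) (n₂ * degree) ⟩
    2 ^ (edges D₁′ + edges D₂) * 2 ^ (n₂ * degree) ≡⟨ cong₂ _*_ (^-distribˡ-+-* 2 (edges D₁′) (edges D₂))
                                                               (trans (cong (2 ^_) (*-comm n₂ degree))
                                                                      (sym (^-*-assoc 2 degree n₂))) ⟩
    2 ^ edges D₁′ * 2 ^ edges D₂ * (2 ^ degree) ^ n₂ ∎
    where open ≡-Reasoning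

  module _ (T : Tournament) where

    respects : Bool → Fin (m T) → Fin (m T) → Bool
    respects e x y = not e ∨ adj T x y

    admissible : (Fin k → Fin (m T)) → Fin (m T) → Bool
    admissible ψ w = allFin k (λ a → respects (E₁ v (punchIn v a)) w (ψ a))
                   ∧ allFin k (λ a → respects (E₁ (punchIn v a) v) (ψ a) w)

    isHom-insertAt : E₁ v v ≡ false → ∀ ψ w →
      isHom D₁ T (insertAt ψ v w) ≡ isHom D₁′ T ψ ∧ admissible ψ w
    isHom-insertAt noLoop ψ w = begin
      allFin (suc k) (λ x → allFin (suc k) (G x))
        ≡⟨ allFin-cong (suc k) (λ x → allFin-punchIn k v (G x)) ⟩
      allFin (suc k) (λ x → G x v ∧ allFin k (G x ∘ punchIn v))
        ≡⟨ allFin-punchIn k v (λ x → G x v ∧ allFin k (G x ∘ punchIn v)) ⟩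
      (G v v ∧ allFin k (G v ∘ punchIn v))
        ∧ allFin k (λ a → G (punchIn v a) v ∧ allFin k (G (punchIn v a) ∘ punchIn v))
        ≡⟨ cong₂ (λ loop rest → (loop ∧ allFin k (G v ∘ punchIn v)) ∧ rest)
                 (cong (λ e → respects e (φ v) (φ v)) noLoop)
                 (allFin-distrib-∧ k _ _) ⟩
      allFin k (G v ∘ punchIn v)
        ∧ (allFin k (λ a → G (punchIn v a) v)
        ∧ allFin k (λ a → allFin k (G (punchIn v a) ∘ punchIn v)))
        ≡⟨ cong₂ (λ o r → o ∧ r) out-arcs (cong₂ _∧_ in-arcs inner-arcs) ⟩
      Out ∧ (In ∧ isHom D₁′ T ψ)
        ≡⟨ ∧-CS.x∙yz≈z∙xy Out In _ ⟩
      isHom D₁′ T ψ ∧ admissible ψ w ∎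
      where
      open ≡-Reasoning
      φ : Fin (suc k) → Fin (m T)
      φ = insertAt ψ v w
      G : Fin (suc k) → Fin (suc k) → Bool
      G x y = respects (E₁ x y) (φ x) (φ y)
      Out In : Bool
      Out = allFin k (λ a → respects (E₁ v (punchIn v a)) w (ψ a))
      In  = allFin k (λ a → respects (E₁ (punchIn v a) v) (ψ a) w)
      out-arcs : allFin k (G v ∘ punchIn v) ≡ Out
      out-arcs = allFin-cong k λ a →
        cong₂ (respects _) (insertAt-lookup ψ v w) (insertAt-punchIn ψ v w a)
      in-arcs : allFin k (λ a → G (punchIn v a) v) ≡ In
      in-arcs = allFin-cong k λ a →
        cong₂ (respects _) (insertAt-punchIn ψ v w a) (insertAt-lookup ψ v w)
      inner-arcs : allFin k (λ a → allFin k (G (punchIn v a) ∘ punchIn v)) ≡ isHom D₁′ T ψ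
      inner-arcs = allFin-cong k λ a → allFin-cong k λ b →
        cong₂ (respects _) (insertAt-punchIn ψ v w a) (insertAt-punchIn ψ v w b)

    isHom-++ : ∀ ψ χ →
      isHom D T (ψ ++ χ) ≡ isHom D₁′ T ψ ∧ (allFin n₂ (admissible ψ ∘ χ) ∧ isHom D₂ T χ)
    isHom-++ ψ χ = begin
      allFin (k + n₂) (λ x → allFin (k + n₂) (G x))
        ≡⟨ allFin-cong (k + n₂) (λ x → allFin-++ k n₂ (G x)) ⟩
      allFin (k + n₂) (λ x → toHost x ∧ toInner x)
        ≡⟨ allFin-++ k n₂ _ ⟩
      allFin k (λ a → toHost (a ↑ˡ n₂) ∧ toInner (a ↑ˡ n₂))
        ∧ allFin n₂ (λ a → toHost (k ↑ʳ a) ∧ toInner (k ↑ʳ a))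
        ≡⟨ cong₂ _∧_ (allFin-distrib-∧ k _ _) (allFin-distrib-∧ n₂ _ _) ⟩
      (allFin k (toHost ∘ (_↑ˡ n₂)) ∧ allFin k (toInner ∘ (_↑ˡ n₂)))
        ∧ (allFin n₂ (toHost ∘ (k ↑ʳ_)) ∧ allFin n₂ (toInner ∘ (k ↑ʳ_)))
        ≡⟨ cong₂ _∧_ (cong₂ _∧_ host-host host-inner) (cong₂ _∧_ inner-host inner-inner) ⟩
      (isHom D₁′ T ψ ∧ In) ∧ (Out ∧ isHom D₂ T χ)
        ≡⟨ trans (∧-assoc (isHom D₁′ T ψ) In _)
                 (cong (isHom D₁′ T ψ ∧_) (∧-CS.x∙yz≈yx∙z In Out _)) ⟩
      isHom D₁′ T ψ ∧ ((Out ∧ In) ∧ isHom D₂ T χ)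
        ≡⟨ cong (λ a → isHom D₁′ T ψ ∧ (a ∧ isHom D₂ T χ)) (sym (allFin-distrib-∧ n₂ _ _)) ⟩
      isHom D₁′ T ψ ∧ (allFin n₂ (admissible ψ ∘ χ) ∧ isHom D₂ T χ) ∎
      where
      open ≡-Reasoning
      G : Fin (k + n₂) → Fin (k + n₂) → Bool
      G x y = respects (E D x y) ((ψ ++ χ) x) ((ψ ++ χ) y)
      toHost toInner : Fin (k + n₂) → Bool
      toHost  x = allFin k (λ b → G x (b ↑ˡ n₂))
      toInner x = allFin n₂ (λ b → G x (k ↑ʳ b))
      Out In : Bool
      Out = allFin n₂ (λ b → allFin k (λ a → respects (E₁ v (punchIn v a)) (χ b) (ψ a)))
      In  = allFin n₂ (λ b → allFin k (λ a → respects (E₁ (punchIn v a) v) (ψ a) (χ b)))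
      host-host : allFin k (toHost ∘ (_↑ˡ n₂)) ≡ isHom D₁′ T ψ
      host-host = allFin-cong k λ a → allFin-cong k λ b → G-↑ˡ-↑ˡ a b
        where
        G-↑ˡ-↑ˡ : ∀ a b → G (a ↑ˡ n₂) (b ↑ˡ n₂) ≡ respects (E₁ (punchIn v a) (punchIn v b)) (ψ a) (ψ b)
        G-↑ˡ-↑ˡ a b rewrite splitAt-↑ˡ k a n₂ | splitAt-↑ˡ k b n₂ = refl
      host-inner : allFin k (toInner ∘ (_↑ˡ n₂)) ≡ In
      host-inner = trans (allFin-cong k λ a → allFin-cong n₂ λ b → G-↑ˡ-↑ʳ a b) (allFin-comm k n₂ _)
        where
        G-↑ˡ-↑ʳ : ∀ a b → G (a ↑ˡ n₂) (k ↑ʳ b) ≡ respects (E₁ (punchIn v a) v) (ψ a) (χ b)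
        G-↑ˡ-↑ʳ a b rewrite splitAt-↑ˡ k a n₂ | splitAt-↑ʳ k n₂ b = refl
      inner-host : allFin n₂ (toHost ∘ (k ↑ʳ_)) ≡ Out
      inner-host = allFin-cong n₂ λ b → allFin-cong k λ a → G-↑ʳ-↑ˡ b a
        where
        G-↑ʳ-↑ˡ : ∀ b a → G (k ↑ʳ b) (a ↑ˡ n₂) ≡ respects (E₁ v (punchIn v a)) (χ b) (ψ a)
        G-↑ʳ-↑ˡ b a rewrite splitAt-↑ʳ k n₂ b | splitAt-↑ˡ k a n₂ = refl
      inner-inner : allFin n₂ (toInner ∘ (k ↑ʳ_)) ≡ isHom D₂ T χ
      inner-inner = allFin-cong n₂ λ a → allFin-cong n₂ λ b → G-↑ʳ-↑ʳ a b
        where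
        G-↑ʳ-↑ʳ : ∀ a b → G (k ↑ʳ a) (k ↑ʳ b) ≡ respects (E₂ a b) (χ a) (χ b)
        G-↑ʳ-↑ʳ a b rewrite splitAt-↑ʳ k n₂ a | splitAt-↑ʳ k n₂ b = refl

    homCount-host : E₁ v v ≡ false →
      homCount D₁ T ≡ sumMaps k (m T) (λ ψ → ind (isHom D₁′ T ψ) * count (m T) (admissible ψ))
    homCount-host noLoop = begin
      sumMaps (suc k) (m T) (ind ∘ isHom D₁ T)
        ≡⟨ sumMaps-insertAt k (m T) v _ (isHom-extensional D₁ T) ⟩
      sumMaps k (m T) (λ ψ → sumFin (m T) (λ w → ind (isHom D₁ T (insertAt ψ v w))))
        ≡⟨ sumMaps-cong k (m T) (λ ψ → trans (sumFin-cong (m T) (split ψ))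
                                             (sumFin-*ˡ (m T) (ind (isHom D₁′ T ψ)) _)) ⟩
      sumMaps k (m T) (λ ψ → ind (isHom D₁′ T ψ) * count (m T) (admissible ψ)) ∎
      where
      open ≡-Reasoning
      split : ∀ ψ w → ind (isHom D₁ T (insertAt ψ v w))
                    ≡ ind (isHom D₁′ T ψ) * ind (admissible ψ w)
      split ψ w = trans (cong ind (isHom-insertAt noLoop ψ w)) (ind-∧ (isHom D₁′ T ψ) _)

    homCount-substitute :
      homCount D T ≡ sumMaps k (m T) (λ ψ → ind (isHom D₁′ T ψ) * homCount D₂ (induced T (admissible ψ)))
    homCount-substitute = begin
      sumMaps (k + n₂) (m T) (ind ∘ isHom D T)
        ≡⟨ sumMaps-++ k n₂ (m T) _ (isHom-extensional D T) ⟩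
      sumMaps k (m T) (λ ψ → sumMaps n₂ (m T) (λ χ → ind (isHom D T (ψ ++ χ))))
        ≡⟨ sumMaps-cong k (m T) (λ ψ → trans (sumMaps-cong n₂ (m T) (split ψ))
                                             (sumMaps-*ˡ n₂ (m T) (ind (isHom D₁′ T ψ)) _)) ⟩
      sumMaps k (m T) (λ ψ → ind (isHom D₁′ T ψ)
        * sumMaps n₂ (m T) (λ χ → ind (allFin n₂ (admissible ψ ∘ χ)) * ind (isHom D₂ T χ)))
        ≡⟨ sumMaps-cong k (m T) (λ ψ → cong (ind (isHom D₁′ T ψ) *_)
                                             (sym (homCount-induced D₂ T (admissible ψ)))) ⟩
      sumMaps k (m T) (λ ψ → ind (isHom D₁′ T ψ) * homCount D₂ (induced T (admissible ψ))) ∎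
      where
      open ≡-Reasoning
      split : ∀ ψ χ → ind (isHom D T (ψ ++ χ))
        ≡ ind (isHom D₁′ T ψ) * (ind (allFin n₂ (admissible ψ ∘ χ)) * ind (isHom D₂ T χ))
      split ψ χ = trans (cong ind (isHom-++ ψ χ))
                        (trans (ind-∧ (isHom D₁′ T ψ) _)
                               (cong (ind (isHom D₁′ T ψ) *_) (ind-∧ (allFin n₂ (admissible ψ ∘ χ)) _)))

-- Inequalities

mixed-powers-≤ : ∀ x y p → x * y ^ p + y * x ^ p ≤ x ^ suc p + y ^ suc p
mixed-powers-≤ x y p = [ ordered x y , swapped ]′ (≤-total y x)
  where
  ordered : ∀ x y → y ≤ x → x * y ^ p + y * x ^ p ≤ x ^ suc p + y ^ suc p
  ordered x y y≤x with m≤n⇒∃[o]m+o≡n y≤x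
  ... | d , refl = begin
    (y + d) * Y + y * X    ≡⟨ lhs y d X Y ⟩
    y * Y + y * X + d * Y  ≤⟨ +-monoʳ-≤ (y * Y + y * X) (*-monoʳ-≤ d (^-monoˡ-≤ p y≤x)) ⟩
    y * Y + y * X + d * X  ≡⟨ rhs y d X Y ⟩
    (y + d) * X + y * Y    ∎
    where
    open ≤-Reasoning
    X Y : ℕ
    X = (y + d) ^ p
    Y = y ^ p
    lhs : ∀ y d X Y → (y + d) * Y + y * X ≡ y * Y + y * X + d * Y
    lhs = solve-∀
    rhs : ∀ y d X Y → y * Y + y * X + d * X ≡ (y + d) * X + y * Y
    rhs = solve-∀
  swapped : x ≤ y → x * y ^ p + y * x ^ p ≤ x ^ suc p + y ^ suc p
  swapped x≤y = subst₂ _≤_ (+-comm (y * x ^ p) _) (+-comm (y ^ suc p) _) (ordered y x x≤y)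

sumMaps-product : ∀ v m (F G : (Fin v → Fin m) → ℕ) →
  sumMaps v m (λ φ → sumMaps v m (λ ψ → F φ * G ψ)) ≡ sumMaps v m F * sumMaps v m G
sumMaps-product v m F G =
  trans (sumMaps-cong v m (λ φ → sumMaps-*ˡ v m (F φ) G)) (sumMaps-*ʳ v m (sumMaps v m G) F)

half-≤ : ∀ a b → a + a ≤ b + b → a ≤ b
half-≤ a b a+a≤b+b = [ (λ a≤b → a≤b) , (λ b≤a → +-cancelʳ-≤ a a b (≤-trans a+a≤b+b (+-monoʳ-≤ b b≤a))) ]′
                       (≤-total a b)

-- Chebyshev's sum inequality for the similarly ordered sequences x and x ^ p.
chebyshev : ∀ v m (w x : (Fin v → Fin m) → ℕ) p →
  sumMaps v m (λ φ → w φ * x φ) * sumMaps v m (λ φ → w φ * x φ ^ p)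
    ≤ sumMaps v m w * sumMaps v m (λ φ → w φ * x φ ^ suc p)
chebyshev v m w x p = half-≤ _ _ (begin
  A * B + A * B
    ≡⟨ cong (A * B +_) (*-comm A B) ⟩
  A * B + B * A
    ≡⟨ sym (cong₂ _+_ (sumMaps-product v m wx wX) (sumMaps-product v m wX wx)) ⟩
  Σ (λ φ → Σ (λ ψ → wx φ * wX ψ)) + Σ (λ φ → Σ (λ ψ → wX φ * wx ψ))
    ≡⟨ sym (double-distrib-+ (λ φ ψ → wx φ * wX ψ) (λ φ ψ → wX φ * wx ψ)) ⟩
  Σ (λ φ → Σ (λ ψ → wx φ * wX ψ + wX φ * wx ψ))
    ≤⟨ sumMaps-mono-≤ v m (λ φ → sumMaps-mono-≤ v m (λ ψ → pointwise φ ψ)) ⟩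
  Σ (λ φ → Σ (λ ψ → wC φ * w ψ + w φ * wC ψ))
    ≡⟨ double-distrib-+ (λ φ ψ → wC φ * w ψ) (λ φ ψ → w φ * wC ψ) ⟩
  Σ (λ φ → Σ (λ ψ → wC φ * w ψ)) + Σ (λ φ → Σ (λ ψ → w φ * wC ψ))
    ≡⟨ cong₂ _+_ (sumMaps-product v m wC w) (sumMaps-product v m w wC) ⟩
  C * W + W * C
    ≡⟨ cong (_+ W * C) (*-comm C W) ⟩
  W * C + W * C ∎)
  where
  open ≤-Reasoning
  Σ : ((Fin v → Fin m) → ℕ) → ℕ
  Σ = sumMaps v m
  wx wX wC : (Fin v → Fin m) → ℕ
  wx φ = w φ * x φ
  wX φ = w φ * x φ ^ p
  wC φ = w φ * x φ ^ suc p
  A B C W : ℕ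
  A = Σ wx
  B = Σ wX
  C = Σ wC
  W = Σ w
  double-distrib-+ : ∀ (F G : (Fin v → Fin m) → (Fin v → Fin m) → ℕ) → Σ (λ φ → Σ (λ ψ → F φ ψ + G φ ψ))
                            ≡ Σ (λ φ → Σ (F φ)) + Σ (λ φ → Σ (G φ))
  double-distrib-+ F G = trans (sumMaps-cong v m (λ φ → sumMaps-distrib-+ v m (F φ) (G φ)))
                               (sumMaps-distrib-+ v m (λ φ → Σ (F φ)) (λ φ → Σ (G φ)))
  pointwise : ∀ φ ψ → wx φ * wX ψ + wX φ * wx ψ ≤ wC φ * w ψ + w φ * wC ψ
  pointwise φ ψ = subst₂ _≤_ (factor (w φ) (w ψ) (x φ) (x ψ) (x φ ^ p) (x ψ ^ p))
                             (expand (w φ) (w ψ) (x φ) (x ψ) (x φ ^ p) (x ψ ^ p))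
                             (*-monoʳ-≤ (w φ * w ψ) (mixed-powers-≤ (x φ) (x ψ) p))
    where
    factor : ∀ a b s t S T → a * b * (s * T + t * S) ≡ a * s * (b * T) + a * S * (b * t)
    factor = solve-∀
    expand : ∀ a b s t S T → a * b * (s * S + t * T) ≡ a * (s * S) * b + a * (b * (t * T))
    expand = solve-∀

power-mean : ∀ v m (w x : (Fin v → Fin m) → ℕ) p →
  sumMaps v m (λ φ → w φ * x φ) ^ suc p ≤ sumMaps v m w ^ p * sumMaps v m (λ φ → w φ * x φ ^ suc p)
power-mean v m w x zero = ≤-reflexive (begin
  A * 1                            ≡⟨ *-identityʳ A ⟩
  A                                ≡⟨ sumMaps-cong v m (λ φ → cong (w φ *_) (sym (*-identityʳ (x φ)))) ⟩
  Σ (λ φ → w φ * x φ ^ 1)          ≡⟨ sym (+-identityʳ _) ⟩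
  1 * Σ (λ φ → w φ * x φ ^ 1)      ∎)
  where
  open ≡-Reasoning
  Σ : ((Fin v → Fin m) → ℕ) → ℕ
  Σ = sumMaps v m
  A : ℕ
  A = Σ (λ φ → w φ * x φ)
power-mean v m w x (suc p) = begin
  A * A ^ suc p                 ≤⟨ *-monoʳ-≤ A (power-mean v m w x p) ⟩
  A * (W ^ p * Σ (wxⁿ (suc p)))  ≡⟨ *-CS.x∙yz≈y∙xz A (W ^ p) _ ⟩
  W ^ p * (A * Σ (wxⁿ (suc p)))  ≤⟨ *-monoʳ-≤ (W ^ p) (chebyshev v m w x (suc p)) ⟩
  W ^ p * (W * Σ (wxⁿ (suc (suc p)))) ≡⟨ sym (*-CS.x∙yz≈y∙xz W (W ^ p) _) ⟩
  W * (W ^ p * Σ (wxⁿ (suc (suc p)))) ≡⟨ sym (*-assoc W (W ^ p) _) ⟩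
  W * W ^ p * Σ (wxⁿ (suc (suc p))) ∎
  where
  open ≤-Reasoning
  Σ : ((Fin v → Fin m) → ℕ) → ℕ
  Σ = sumMaps v m
  wxⁿ : ℕ → (Fin v → Fin m) → ℕ
  wxⁿ q φ = w φ * x φ ^ q
  A W : ℕ
  A = Σ (λ φ → w φ * x φ)
  W = Σ w

^-distribʳ-* : ∀ a b p → (a * b) ^ p ≡ a ^ p * b ^ p
^-distribʳ-* a b zero    = refl
^-distribʳ-* a b (suc p) = trans (cong (a * b *_) (^-distribʳ-* a b p)) (*-CS.interchange a b _ _)

suc-^-≤ : ∀ x ℓ → suc x ^ suc ℓ ≤ x ^ suc ℓ + suc ℓ * suc x ^ ℓ
suc-^-≤ x zero = ≤-reflexive (base x)
  where
  base : ∀ x → suc x * 1 ≡ x * 1 + 1 * 1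
  base = solve-∀
suc-^-≤ x (suc ℓ) = begin
  suc x * suc x ^ suc ℓ                 ≤⟨ *-monoʳ-≤ (suc x) (suc-^-≤ x ℓ) ⟩
  suc x * (X + suc ℓ * Y)               ≡⟨ expand x X (suc ℓ) Y ⟩
  x * X + X + suc ℓ * (suc x * Y)       ≤⟨ +-monoˡ-≤ _ (+-monoʳ-≤ (x * X) (^-monoˡ-≤ (suc ℓ) (n≤1+n x))) ⟩
  x * X + suc x * Y + suc ℓ * (suc x * Y) ≡⟨ +-assoc (x * X) _ _ ⟩
  x * X + suc (suc ℓ) * (suc x * Y)     ∎
  where
  open ≤-Reasoning
  X Y : ℕ
  X = x ^ suc ℓ
  Y = suc x ^ ℓ
  expand : ∀ x X l Y → suc x * (X + l * Y) ≡ x * X + X + l * (suc x * Y)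
  expand = solve-∀

-- The error term Y ≤ X / (K + 1) is absorbed into the left-hand side.
absorb : ∀ K A B X Y Z .{{_ : NonZero B}} →
  K * B + 1 ≤ suc K * A → A * X ≤ Y + B * Z → suc K * Y ≤ X → K * X ≤ suc K * Z
absorb K A B X Y Z gap AX≤Y+BZ [1+K]Y≤X = *-cancelˡ-≤ B (+-cancelʳ-≤ X _ _ (begin
  B * (K * X) + X              ≡⟨ collect B K X ⟩
  (K * B + 1) * X              ≤⟨ *-monoˡ-≤ X gap ⟩
  suc K * A * X                ≡⟨ *-assoc (suc K) A X ⟩
  suc K * (A * X)              ≤⟨ *-monoʳ-≤ (suc K) AX≤Y+BZ ⟩
  suc K * (Y + B * Z)          ≡⟨ *-distribˡ-+ (suc K) Y (B * Z) ⟩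
  suc K * Y + suc K * (B * Z)  ≤⟨ +-monoˡ-≤ (suc K * (B * Z)) [1+K]Y≤X ⟩
  X + suc K * (B * Z)          ≡⟨ rearrange X (suc K) B Z ⟩
  B * (suc K * Z) + X          ∎))
  where
  open ≤-Reasoning
  collect : ∀ B K X → B * (K * X) + X ≡ (K * B + 1) * X
  collect = solve-∀
  rearrange : ∀ X s B Z → X + s * (B * Z) ≡ B * (s * Z) + X
  rearrange = solve-∀

module Estimate (K ℓ : ℕ) where

  -- The accuracies at which the Sidorenko property of D₁ and of D₂ is invoked; accuracy-gap says
  -- that the combined loss (1 + 1/K₁)^{v(D₂)} (1 + 1/K₂) stays below (K + 1)/K.
  K₁ K₂ : ℕ
  K₁ = suc ℓ * (2 * K + 2)
  K₂ = 2 * K + 1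

  accuracy-gap : K * (suc K₁ ^ suc ℓ * suc K₂) + 1 ≤ suc K * (K₁ ^ suc ℓ * K₂)
  accuracy-gap = +-cancelʳ-≤ (U * (suc ℓ * Y)) _ _ (begin
    K * (suc K₁ ^ suc ℓ * suc K₂) + 1 + U * (suc ℓ * Y)
      ≤⟨ +-monoˡ-≤ (U * (suc ℓ * Y)) (+-monoʳ-≤ (K * (suc K₁ ^ suc ℓ * suc K₂)) 1≤slack) ⟩
    K * (suc K₁ ^ suc ℓ * suc K₂) + suc K * suc (suc ℓ) * Y + U * (suc ℓ * Y)
      ≡⟨ identity K (suc ℓ) Y ⟩
    U * suc K₁ ^ suc ℓ
      ≤⟨ *-monoʳ-≤ U (suc-^-≤ K₁ ℓ) ⟩
    U * (K₁ ^ suc ℓ + suc ℓ * Y)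
      ≡⟨ *-distribˡ-+ U (K₁ ^ suc ℓ) (suc ℓ * Y) ⟩
    U * K₁ ^ suc ℓ + U * (suc ℓ * Y)
      ≡⟨ cong (_+ U * (suc ℓ * Y)) (*-CS.xy∙z≈x∙zy (suc K) K₂ (K₁ ^ suc ℓ)) ⟩
    suc K * (K₁ ^ suc ℓ * K₂) + U * (suc ℓ * Y) ∎)
    where
    open ≤-Reasoning
    U Y : ℕ
    U = suc K * K₂
    Y = suc K₁ ^ ℓ
    1≤slack : 1 ≤ suc K * suc (suc ℓ) * Y
    1≤slack = ≤-trans (m^n>0 (suc K₁) ℓ) (m≤n*m Y (suc K * suc (suc ℓ)))
    identity : ∀ K n Y → K * (suc (n * (2 * K + 2)) * Y * suc (2 * K + 1)) + suc K * suc n * Y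
                           + suc K * (2 * K + 1) * (n * Y)
                       ≡ suc K * (2 * K + 1) * (suc (n * (2 * K + 2)) * Y)
    identity = solve-∀

  -- In the application w ψ = [ψ is a homomorphism], c ψ = |N(ψ)|, h ψ = h(D₂, T[N(ψ)]),
  -- P = 2^{e(D₁ − v)}, Q = 2^{deg v}, R = 2^{e(D₂)}, and B bounds the additive error of D₂.
  module _ {k m : ℕ} (w c h : (Fin k → Fin m) → ℕ) (P Q R B : ℕ) where

    Σ : ((Fin k → Fin m) → ℕ) → ℕ
    Σ = sumMaps k m

    host-estimate : .{{NonZero m}} → P * Σ w ≤ m ^ k →
      K₁ * m ^ suc k ≤ suc K₁ * (P * Q) * Σ (λ ψ → w ψ * c ψ) →
      K₁ ^ suc ℓ * (m ^ k * m ^ suc ℓ)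
        ≤ suc K₁ ^ suc ℓ * Q ^ suc ℓ * P * Σ (λ ψ → w ψ * c ψ ^ suc ℓ)
    host-estimate anti sid = *-cancelʳ-≤ _ _ (a ^ ℓ) {{m^n≢0 a ℓ {{m^n≢0 m k}}}} (begin
      K₁ ^ suc ℓ * (a * M) * a ^ ℓ
        ≡⟨ regroup-lhs (K₁ ^ suc ℓ) a M (a ^ ℓ) ⟩
      K₁ ^ suc ℓ * (M * a ^ suc ℓ)
        ≡⟨ cong (K₁ ^ suc ℓ *_) (sym (^-distribʳ-* m a (suc ℓ))) ⟩
      K₁ ^ suc ℓ * (m * a) ^ suc ℓ
        ≡⟨ sym (^-distribʳ-* K₁ (m * a) (suc ℓ)) ⟩
      (K₁ * (m * a)) ^ suc ℓ
        ≤⟨ ^-monoˡ-≤ (suc ℓ) sid ⟩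
      (suc K₁ * (P * Q) * S₁) ^ suc ℓ
        ≡⟨ trans (^-distribʳ-* (suc K₁ * (P * Q)) S₁ (suc ℓ))
                 (cong (_* S₁ ^ suc ℓ) (trans (^-distribʳ-* (suc K₁) (P * Q) (suc ℓ))
                                              (cong (suc K₁ ^ suc ℓ *_) (^-distribʳ-* P Q (suc ℓ))))) ⟩
      suc K₁ ^ suc ℓ * (P * P ^ ℓ * Q ^ suc ℓ) * S₁ ^ suc ℓ
        ≤⟨ *-monoʳ-≤ (suc K₁ ^ suc ℓ * (P * P ^ ℓ * Q ^ suc ℓ)) (power-mean k m w c ℓ) ⟩
      suc K₁ ^ suc ℓ * (P * P ^ ℓ * Q ^ suc ℓ) * (Σ w ^ ℓ * S)
        ≡⟨ regroup-rhs (suc K₁ ^ suc ℓ) P (P ^ ℓ) (Q ^ suc ℓ) (Σ w ^ ℓ) S ⟩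
      suc K₁ ^ suc ℓ * Q ^ suc ℓ * P * S * (P ^ ℓ * Σ w ^ ℓ)
        ≡⟨ cong (suc K₁ ^ suc ℓ * Q ^ suc ℓ * P * S *_) (sym (^-distribʳ-* P (Σ w) ℓ)) ⟩
      suc K₁ ^ suc ℓ * Q ^ suc ℓ * P * S * (P * Σ w) ^ ℓ
        ≤⟨ *-monoʳ-≤ (suc K₁ ^ suc ℓ * Q ^ suc ℓ * P * S) (^-monoˡ-≤ ℓ anti) ⟩
      suc K₁ ^ suc ℓ * Q ^ suc ℓ * P * S * a ^ ℓ ∎)
      where
      open ≤-Reasoning
      a M S₁ S : ℕ
      a  = m ^ k
      M  = m ^ suc ℓ
      S₁ = Σ (λ ψ → w ψ * c ψ)
      S  = Σ (λ ψ → w ψ * c ψ ^ suc ℓ)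
      regroup-lhs : ∀ k a M x → k * (a * M) * x ≡ k * (M * (a * x))
      regroup-lhs = solve-∀
      regroup-rhs : ∀ s p pl q wl S → s * (p * pl * q) * (wl * S) ≡ s * q * p * S * (pl * wl)
      regroup-rhs = solve-∀

    inner-estimate : (∀ ψ → K₂ * c ψ ^ suc ℓ ≤ K₂ * B + suc K₂ * R * h ψ) →
      K₂ * Σ (λ ψ → w ψ * c ψ ^ suc ℓ) ≤ K₂ * B * Σ w + suc K₂ * R * Σ (λ ψ → w ψ * h ψ)
    inner-estimate sid = begin
      K₂ * Σ (λ ψ → w ψ * c ψ ^ suc ℓ)
        ≡⟨ sym (sumMaps-*ˡ k m K₂ _) ⟩
      Σ (λ ψ → K₂ * (w ψ * c ψ ^ suc ℓ))
        ≡⟨ sumMaps-cong k m (λ ψ → *-CS.x∙yz≈y∙xz K₂ (w ψ) _) ⟩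
      Σ (λ ψ → w ψ * (K₂ * c ψ ^ suc ℓ))
        ≤⟨ sumMaps-mono-≤ k m (λ ψ → *-monoʳ-≤ (w ψ) (sid ψ)) ⟩
      Σ (λ ψ → w ψ * (K₂ * B + suc K₂ * R * h ψ))
        ≡⟨ sumMaps-cong k m (λ ψ → spread (w ψ) (K₂ * B) (suc K₂ * R) (h ψ)) ⟩
      Σ (λ ψ → K₂ * B * w ψ + suc K₂ * R * (w ψ * h ψ))
        ≡⟨ sumMaps-distrib-+ k m _ _ ⟩
      Σ (λ ψ → K₂ * B * w ψ) + Σ (λ ψ → suc K₂ * R * (w ψ * h ψ))
        ≡⟨ cong₂ _+_ (sumMaps-*ˡ k m (K₂ * B) w) (sumMaps-*ˡ k m (suc K₂ * R) _) ⟩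
      K₂ * B * Σ w + suc K₂ * R * Σ (λ ψ → w ψ * h ψ) ∎
      where
      open ≤-Reasoning
      spread : ∀ w x y h → w * (x + y * h) ≡ x * w + y * (w * h)
      spread = solve-∀

    substitution-estimate :
      suc K * (suc K₁ ^ suc ℓ * Q ^ suc ℓ * K₂ * B) < m →
      P * Σ w ≤ m ^ k →
      K₁ * m ^ suc k ≤ suc K₁ * (P * Q) * Σ (λ ψ → w ψ * c ψ) →
      (∀ ψ → K₂ * c ψ ^ suc ℓ ≤ K₂ * B + suc K₂ * R * h ψ) →
      K * m ^ (k + suc ℓ) ≤ suc K * (P * R * Q ^ suc ℓ) * Σ (λ ψ → w ψ * h ψ)
    substitution-estimate large anti sid₁ sid₂ = begin
      K * m ^ (k + suc ℓ)  ≡⟨ cong (K *_) (^-distribˡ-+-* m k (suc ℓ)) ⟩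
      K * (a * M)          ≤⟨ absorb K (K₁ ^ suc ℓ * K₂) Bc (a * M) (C * a) (Eₛ * H)
                                     {{m*n≢0 (suc K₁ ^ suc ℓ) (suc K₂) {{m^n≢0 (suc K₁) (suc ℓ)}}}}
                                     accuracy-gap combined small ⟩
      suc K * (Eₛ * H)      ≡⟨ sym (*-assoc (suc K) Eₛ H) ⟩
      suc K * Eₛ * H        ∎
      where
      open ≤-Reasoning
      instance
        m≢0 : NonZero m
        m≢0 = >-nonZero (≤-trans (s≤s z≤n) large)
      a M W S H Bk Bc C Eₛ : ℕ
      a  = m ^ k
      M  = m ^ suc ℓ
      W  = Σ w
      S  = Σ (λ ψ → w ψ * c ψ ^ suc ℓ)
      H  = Σ (λ ψ → w ψ * h ψ)
      Bk = suc K₁ ^ suc ℓ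
      Bc = Bk * suc K₂
      C  = Bk * Q ^ suc ℓ * K₂ * B
      Eₛ = P * R * Q ^ suc ℓ
      combined : K₁ ^ suc ℓ * K₂ * (a * M) ≤ C * a + Bc * (Eₛ * H)
      combined = begin
        K₁ ^ suc ℓ * K₂ * (a * M)              ≡⟨ *-CS.xy∙z≈y∙xz (K₁ ^ suc ℓ) K₂ (a * M) ⟩
        K₂ * (K₁ ^ suc ℓ * (a * M))            ≤⟨ *-monoʳ-≤ K₂ (host-estimate anti sid₁) ⟩
        K₂ * (Bk * Q ^ suc ℓ * P * S)          ≡⟨ *-CS.x∙yz≈y∙xz K₂ (Bk * Q ^ suc ℓ * P) S ⟩
        Bk * Q ^ suc ℓ * P * (K₂ * S)          ≤⟨ *-monoʳ-≤ (Bk * Q ^ suc ℓ * P) (inner-estimate sid₂) ⟩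
        Bk * Q ^ suc ℓ * P * (K₂ * B * W + suc K₂ * R * H)
                                               ≡⟨ regroup Bk (Q ^ suc ℓ) P K₂ B W R H ⟩
        C * (P * W) + Bc * (Eₛ * H)            ≤⟨ +-monoˡ-≤ (Bc * (Eₛ * H)) (*-monoʳ-≤ C anti) ⟩
        C * a + Bc * (Eₛ * H)                  ∎
        where
        regroup : ∀ b q p k B W R H → b * q * p * (k * B * W + suc k * R * H)
                                    ≡ b * q * k * B * (p * W) + b * suc k * (p * R * q * H)
        regroup = solve-∀
      small : suc K * (C * a) ≤ a * M
      small = begin
        suc K * (C * a)  ≡⟨ sym (*-assoc (suc K) C a) ⟩
        suc K * C * a    ≤⟨ *-monoˡ-≤ a (≤-trans (<⇒≤ large) (m≤m*n m (m ^ ℓ) {{m^n≢0 m ℓ}})) ⟩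
        M * a            ≡⟨ *-comm M a ⟩
        a * M            ∎

sidorenko-all-sizes : ∀ D {K N} →
  (∀ T → N ≤ m T → K * m T ^ n D ≤ suc K * 2 ^ edges D * homCount D T) →
  ∀ T → K * m T ^ n D ≤ K * N ^ n D + suc K * 2 ^ edges D * homCount D T
sidorenko-all-sizes D {K} {N} sid T with N ≤? m T
... | yes N≤m = ≤-trans (sid T N≤m) (m≤n+m _ _)
... | no  N≰m = ≤-trans (*-monoʳ-≤ K (^-monoˡ-≤ (n D) (<⇒≤ (≰⇒> N≰m)))) (m≤m+n _ _)

theorem4p8 : (D₁ D₂ : Digraph) → Oriented D₁ → Oriented D₂ →
    2 ≤ n D₁ → 2 ≤ n D₂ →
    TournamentSidorenko D₁ → TournamentSidorenko D₂ →
    (v : Fin (n D₁)) → TournamentAntiSidorenko (deleteVertex D₁ v) →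
    TournamentSidorenko (substitute D₁ v D₂)
theorem4p8 (mkDigraph zero _) _ _ _ () _ _ _ _ _
theorem4p8 (mkDigraph (suc k) _) (mkDigraph zero _) _ _ _ () _ _ _ _
theorem4p8 (mkDigraph (suc k) E₁) (mkDigraph (suc ℓ) E₂) oriented₁ _ _ _ sid₁ sid₂ v anti K =
  N₁ + suc (suc K * C) , λ T N≤m →
    subst₂ (λ p h → K * m T ^ (k + suc ℓ) ≤ suc K * p * h)
      (sym 2^edges-substitute) (sym (homCount-substitute T))
      (substitution-estimate (ind ∘ isHom D₁′ T) (count (m T) ∘ admissible T)
        (homCount D₂ ∘ induced T ∘ admissible T) (2 ^ edges D₁′) (2 ^ degree) (2 ^ edges D₂) B
        (≤-trans (m≤n+m _ N₁) N≤m)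
        (anti T)
        (subst₂ (λ p h → K₁ * m T ^ suc k ≤ suc K₁ * p * h)
          (2^edges-host noLoop) (homCount-host T noLoop) (proj₂ (sid₁ K₁) T (≤-trans (m≤m+n N₁ _) N≤m)))
        (λ ψ → sidorenko-all-sizes D₂ {K₂} (proj₂ (sid₂ K₂)) (induced T (admissible T ψ))))
  where
  open Substitution E₁ v E₂
  open Estimate K ℓ
  noLoop : E₁ v v ≡ false
  noLoop = Oriented.noLoop oriented₁ v
  N₁ B C : ℕ
  N₁ = proj₁ (sid₁ K₁)
  B  = proj₁ (sid₂ K₂) ^ suc ℓ
  C  = suc K₁ ^ suc ℓ * (2 ^ degree) ^ suc ℓ * K₂ * B
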